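{- Let $s\ge3$ and $m\ge1$ be integers and let $j_1>j_2>\cdots>j_s$ be positive integers. Then a positive integer $n$ coprime to $p_{j_1}\cdots p_{j_s}$ can be written as \[ n=\sum_{i=1}^s x_i\prod_{h\in[s]\setminus\{i\}}p_{j_h}^m \] with positive integers $x_1,\ldots,x_s$ such that $(x_1,\ldots,x_s)_m=1$ and $(p_{j_1},x_1)=\cdots=(p_{j_s},x_s)=1$, provided one of the following holds: (1) $n\ge\Big(s+1+2^{(m+1)s}\prod_{j=1,\,j\notin\{j_1,\ldots,j_s\}}^{j_1-(m+1)s-1}p_j\Big)\Big(\prod_{i=1}^s p_{j_i}^m\Big)$ and $p_{j_1-(m+1)s}>2^{(m+1)s}$; (2) $n\ge(s+1)\Big(\prod_{j=1}^{j_1}p_j\Big)\Big(\prod_{i=1}^s p_{j_i}^{m-1}\Big)$.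
   Context: $[s]=\{1,\ldots,s\}$. $p_j$ denotes the $j$-th prime number in increasing order ($p_1=2$), with the convention $p_j=1$ for integers $j\le0$; an empty product equals $1$. $(b_1,\ldots,b_k)$ is the greatest common divisor and $(b_1,\ldots,b_k)_m$ is the largest integer of the form $d^m$, $d\in\mathbb{N}$, dividing all of $b_1,\ldots,b_k$. -}

module Defs where

open import Data.Nat using (ℕ; zero; suc; _+_; _*_; _∸_; _^_; _≤_; _<_; _!)
open import Data.Nat.Divisibility using (_∣_)
open import Data.Nat.Primality using (prime?)
open import Data.Fin using (Fin) renaming (zero to fzero; suc to fsuc)
import Data.Fin.Properties as FinP
open import Data.Bool using (if_then_else_)
open import Data.Product using (∃)
open import Relation.Nullary using (yes; no; does)
open import Relation.Binary.PropositionalEquality using (_≡_)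

searchPrime : ℕ → ℕ → ℕ
searchPrime zero c = c
searchPrime (suc f) c with prime? c
... | yes _ = c
... | no _ = searchPrime f (suc c)

-- p j : the j-th prime (p 1 = 2), with p 0 = 1 (convention p_j = 1 for j ≤ 0).
-- The next prime after q lies in (q, q! + 1], so a search of q! steps from q+1 finds it.
p : ℕ → ℕ
p zero = 1
p (suc zero) = 2
p (suc (suc j)) = searchPrime (p (suc j) !) (suc (p (suc j)))

∑ : (s : ℕ) → (Fin s → ℕ) → ℕ
∑ zero f = 0
∑ (suc s) f = f fzero + ∑ s (λ i → f (fsuc i))

∏ : (s : ℕ) → (Fin s → ℕ) → ℕ
∏ zero f = 1
∏ (suc s) f = f fzero * ∏ s (λ i → f (fsuc i))

∏except : (s : ℕ) → Fin s → (Fin s → ℕ) → ℕ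
∏except s i f = ∏ s (λ h → if does (h FinP.≟ i) then 1 else f h)

∏range : ℕ → (ℕ → ℕ) → ℕ
∏range zero f = 1
∏range (suc b) f = ∏range b f * f (suc b)

∏primesAvoiding : (s : ℕ) → (Fin s → ℕ) → ℕ → ℕ
∏primesAvoiding s js b =
  ∏range b (λ j → if does (FinP.any? (λ i → j Data.Nat.≟ js i)) then 1 else p j)
  where import Data.Nat

-- "(x_1,…,x_s)_m = g": g is the largest integer of the form d^m dividing all x_i
IsPowGcd : (m s : ℕ) → (Fin s → ℕ) → ℕ → Set
IsPowGcd m s x g =
  (∃ λ d → g ≡ d ^ m × ((i : Fin s) → g ∣ x i))
  × ((d : ℕ) → ((i : Fin s) → d ^ m ∣ x i) → d ^ m ≤ g)
  where open import Data.Product using (_×_)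

first : {s : ℕ} → 3 ≤ s → (Fin s → ℕ) → ℕ
first {suc s} _ js = js fzero

{-# OPTIONS --safe #-}
module Submission where

-- Write q i = p (js i), M i = q i ^ m, Q i = ∏_{h ≠ i} M h and P = ∏ M i. As Q i is invertible
-- modulo M i there are residues r i < M i with r i * Q i ≡ n (mod M i), so by the Chinese
-- remainder theorem n = R + T * P with R = ∑ r i * Q i ≤ s * P. Every x i = r i + t i * M i with
-- ∑ t i = T then represents n, and q i ∤ x i because q i ∤ n. Taking t = (T - k, k, 0, …, 0)
-- leaves x_s = r_s < q_s ^ m, so a common divisor d ^ m with d > 1 would give a prime ℓ < q_s
-- dividing x₂ = r₂ + k * M₂. It remains to choose k ≤ T such that x₂ has no prime factor below q_s:
-- the primes dividing a product A of small primes are avoided by fixing k modulo A, and the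
-- remaining ones, fewer than K and each at least K, each divide x₂ for at most one of K such
-- choices of k, so one choice survives. The size hypotheses guarantee T ≥ K * A; in case (2)
-- K = 1 and A is the product of all primes below q_s.

open import Defs
open import Data.Nat
open import Data.Nat.Properties
open import Data.Nat.Divisibility
open import Data.Nat.DivMod using (_%_; _/_; m%n<n; m≡m%n+[m/n]*n)
open import Data.Nat.Primality
open import Data.Nat.Primality.Factorisation using (factorise)
open import Data.Nat.Coprimality as Coprimality using (Coprime; coprime-divisor; coprime-Bézout)
open import Data.Nat.GCD using (module Bézout)
open import Data.Nat.Tactic.RingSolver using (solve-∀)
open import Data.Fin using (Fin; zero; suc; fromℕ; toℕ)
import Data.Fin
import Data.Fin.Properties as Fin
open import Data.List using ([]; _∷_)
open import Data.List.Relation.Unary.All using (_∷_)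
open import Data.Bool using (if_then_else_)
open import Data.Empty using (⊥; ⊥-elim)
open import Data.Product using (_×_; _,_; proj₁; proj₂; ∃; ∃₂; map₁; map₂; uncurry)
open import Data.Sum using (_⊎_; inj₁; inj₂; [_,_]′)
open import Function using (_∘_; _∘′_)
open import Relation.Nullary using (¬_; Dec; yes; no; does; ¬?)
open import Relation.Nullary.Decidable using (decidable-stable)
open import Relation.Binary.Definitions using (tri<; tri≈; tri>)
open import Relation.Binary.PropositionalEquality
import Algebra.Properties.CommutativeSemigroup +-commutativeSemigroup as +-CS
import Algebra.Properties.CommutativeSemigroup *-commutativeSemigroup as *-CS

private variable
  a b c d ℓ ℓ′ j j′ s : ℕ
  f g : Fin s → ℕ
  i h : Fin s

-- Primes and coprimality

prime⇒≥2 : Prime ℓ → 2 ≤ ℓ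
prime⇒≥2 {ℓ} pℓ = nonTrivial⇒n>1 ℓ {{prime⇒nonTrivial pℓ}}

∃-prime-divisor : 2 ≤ a → ∃ λ ℓ → Prime ℓ × ℓ ∣ a
∃-prime-divisor {suc zero} (s≤s ())
∃-prime-divisor {suc (suc a)} _ with factorise (2 + a)
... | record { factors = [] ; isFactorisation = () }
... | record { factors = ℓ ∷ ℓs ; isFactorisation = eq ; factorsPrime = pℓ ∷ _ } =
  ℓ , pℓ , subst (ℓ ∣_) (sym eq) (m∣m*n _)

prime∣prime⇒≡ : Prime ℓ → Prime ℓ′ → ℓ ∣ ℓ′ → ℓ ≡ ℓ′
prime∣prime⇒≡ pℓ pℓ′ ℓ∣ℓ′ with prime⇒irreducible pℓ′ ℓ∣ℓ′
... | inj₁ refl = ⊥-elim (¬prime[1] pℓ)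
... | inj₂ ℓ≡ℓ′ = ℓ≡ℓ′

prime∣^⇒∣ : ∀ k → Prime ℓ → ℓ ∣ a ^ k → ℓ ∣ a
prime∣^⇒∣ zero pℓ ℓ∣1 = ⊥-elim (¬prime[1] (subst Prime (∣1⇒≡1 ℓ∣1) pℓ))
prime∣^⇒∣ {a = a} (suc k) pℓ ℓ∣a^k+1 with euclidsLemma a (a ^ k) pℓ ℓ∣a^k+1
... | inj₁ ℓ∣a = ℓ∣a
... | inj₂ ℓ∣a^k = prime∣^⇒∣ k pℓ ℓ∣a^k

prime∤⇒coprime : Prime ℓ → ¬ ℓ ∣ a → Coprime ℓ a
prime∤⇒coprime pℓ ℓ∤a (d∣ℓ , d∣a) with prime⇒irreducible pℓ d∣ℓ
... | inj₁ d≡1 = d≡1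
... | inj₂ refl = ⊥-elim (ℓ∤a d∣a)

distinct-primes-coprime : Prime ℓ → Prime ℓ′ → ℓ ≢ ℓ′ → Coprime ℓ ℓ′
distinct-primes-coprime pℓ pℓ′ ℓ≢ℓ′ = prime∤⇒coprime pℓ (ℓ≢ℓ′ ∘′ prime∣prime⇒≡ pℓ pℓ′)

coprime-1ˡ : Coprime 1 a
coprime-1ˡ (d∣1 , _) = ∣1⇒≡1 d∣1

coprime-∣ˡ : d ∣ a → Coprime a b → Coprime d b
coprime-∣ˡ d∣a a⊥b (e∣d , e∣b) = a⊥b (∣-trans e∣d d∣a , e∣b)

coprime-*ʳ : ∀ {c} → Coprime a b → Coprime a c → Coprime a (b * c)
coprime-*ʳ a⊥b a⊥c (d∣a , d∣bc) = a⊥c (d∣a , coprime-divisor (coprime-∣ˡ d∣a a⊥b) d∣bc)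

coprime-^ʳ : ∀ k → Coprime a b → Coprime a (b ^ k)
coprime-^ʳ zero    a⊥b (_ , d∣1) = ∣1⇒≡1 d∣1
coprime-^ʳ (suc k) a⊥b = coprime-*ʳ a⊥b (coprime-^ʳ k a⊥b)

coprime-^ˡ : ∀ k → Coprime a b → Coprime (a ^ k) b
coprime-^ˡ k a⊥b = Coprimality.sym (coprime-^ʳ k (Coprimality.sym a⊥b))

^-pred : ∀ a k → 1 ≤ k → a ^ k ≡ a * a ^ (k ∸ 1)
^-pred a (suc k) _ = refl

∣-^ : ∀ k → 1 ≤ k → a ∣ a ^ k
∣-^ (suc k) _ = m∣m*n _

^-monoˡ-∣ : ∀ k → a ∣ b → a ^ k ∣ b ^ k
^-monoˡ-∣ zero    a∣b = ∣-refl
^-monoˡ-∣ (suc k) a∣b = *-pres-∣ a∣b (^-monoˡ-∣ k a∣b)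

coprime-∣-* : ∀ {c} → Coprime a b → a ∣ c → b ∣ c → a * b ∣ c
coprime-∣-* {a} {b} a⊥b (divides k refl) b∣ka =
  subst (a * b ∣_) (*-comm a k) (*-monoʳ-∣ a (coprime-divisor (Coprimality.sym a⊥b) b∣ak))
  where
  b∣ak : b ∣ a * k
  b∣ak = subst (b ∣_) (*-comm k a) b∣ka

-- The sequence of primes

searchPrime-≥ : ∀ f c → c ≤ searchPrime f c
searchPrime-≥ zero    c = ≤-refl
searchPrime-≥ (suc f) c with prime? c
... | yes _ = ≤-refl
... | no  _ = ≤-trans (n≤1+n c) (searchPrime-≥ f (suc c))

searchPrime-least : ∀ f c → (∃ λ ℓ → Prime ℓ × c ≤ ℓ × ℓ < c + f) →
  Prime (searchPrime f c) × (∀ ℓ → c ≤ ℓ → ℓ < searchPrime f c → ¬ Prime ℓ)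
searchPrime-least zero c (ℓ , _ , c≤ℓ , ℓ<c+0) =
  ⊥-elim (<⇒≱ ℓ<c+0 (subst (_≤ ℓ) (sym (+-identityʳ c)) c≤ℓ))
searchPrime-least (suc f) c found with prime? c
... | yes pc = pc , λ ℓ c≤ℓ ℓ<c → ⊥-elim (<⇒≱ ℓ<c c≤ℓ)
... | no ¬pc = map₂ extend (searchPrime-least f (suc c) (skip found))
  where
  skip : (∃ λ ℓ → Prime ℓ × c ≤ ℓ × ℓ < c + suc f) → ∃ λ ℓ → Prime ℓ × suc c ≤ ℓ × ℓ < suc c + f
  skip (ℓ , pℓ , c≤ℓ , ℓ<) with m≤n⇒m<n∨m≡n c≤ℓ
  ... | inj₁ c<ℓ = ℓ , pℓ , c<ℓ , subst (ℓ <_) (+-suc c f) ℓ<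
  ... | inj₂ refl = ⊥-elim (¬pc pℓ)
  extend : ∀ {u} → (∀ ℓ → suc c ≤ ℓ → ℓ < u → ¬ Prime ℓ) → ∀ ℓ → c ≤ ℓ → ℓ < u → ¬ Prime ℓ
  extend gap ℓ c≤ℓ ℓ<u with m≤n⇒m<n∨m≡n c≤ℓ
  ... | inj₁ c<ℓ = gap ℓ c<ℓ ℓ<u
  ... | inj₂ refl = ¬pc

-- Euclid: a prime factor of q ! + 1 exceeds q.
larger-prime-within-factorial : ∀ q → 1 ≤ q → ∃ λ ℓ → Prime ℓ × suc q ≤ ℓ × ℓ < suc q + q !
larger-prime-within-factorial q q≥1 with ∃-prime-divisor (s≤s (1≤n! q))
... | ℓ , pℓ , ℓ∣1+q! = ℓ , pℓ , q<ℓ , s≤s (≤-trans (∣⇒≤ ℓ∣1+q!) (+-monoˡ-≤ (q !) q≥1))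
  where
  q<ℓ : q < ℓ
  q<ℓ with q <? ℓ
  ... | yes q<ℓ = q<ℓ
  ... | no  q≮ℓ = ⊥-elim (¬prime[1] (subst Prime (∣1⇒≡1 ℓ∣1) pℓ))
    where
    ℓ∣ℓ! : ∀ {k} → 1 ≤ k → k ∣ k !
    ℓ∣ℓ! {suc k} _ = m∣m*n (k !)
    ℓ∣1 : ℓ ∣ 1
    ℓ∣1 = ∣m+n∣m⇒∣n (subst (ℓ ∣_) (+-comm 1 (q !)) ℓ∣1+q!)
                     (∣-trans (ℓ∣ℓ! (≤-trans (s≤s z≤n) (prime⇒≥2 pℓ))) (m≤n⇒m!∣n! (≮⇒≥ q≮ℓ)))

n<2^n : ∀ n → n < 2 ^ n
n<2^n zero    = s≤s z≤n
n<2^n (suc n) = subst (_≤ 2 ^ n + (2 ^ n + 0)) (+-comm (suc n) 1)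
  (+-mono-≤ (n<2^n n) (subst (1 ≤_) (sym (+-identityʳ (2 ^ n))) (m^n>0 2 n)))

p-positive : ∀ j → 1 ≤ p j
p-positive zero          = ≤-refl
p-positive (suc zero)    = s≤s z≤n
p-positive (suc (suc j)) = ≤-trans (s≤s z≤n) (searchPrime-≥ (p (suc j) !) _)

1<p⇒1≤ : 1 < p j → 1 ≤ j
1<p⇒1≤ {zero}  (s≤s ())
1<p⇒1≤ {suc j} _ = s≤s z≤n

p-next : ∀ j → Prime (p (2 + j)) × (∀ ℓ → suc (p (suc j)) ≤ ℓ → ℓ < p (2 + j) → ¬ Prime ℓ)
p-next j = searchPrime-least (p (suc j) !) (suc (p (suc j)))
             (larger-prime-within-factorial (p (suc j)) (p-positive (suc j)))

p-prime : 1 ≤ j → Prime (p j)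
p-prime {suc zero}    _ = prime[2]
p-prime {suc (suc j)} _ = proj₁ (p-next j)

p-<-suc : ∀ j → p j < p (suc j)
p-<-suc zero    = s≤s (s≤s z≤n)
p-<-suc (suc j) = searchPrime-≥ (p (suc j) !) _

p-gap : ∀ j → p j < ℓ → ℓ < p (suc j) → ¬ Prime ℓ
p-gap zero    (s≤s (s≤s z≤n)) (s≤s (s≤s ()))
p-gap (suc j) = proj₂ (p-next j) _

p-strictMono : j < j′ → p j < p j′
p-strictMono {j} {suc j′} (s≤s j≤j′) with m≤n⇒m<n∨m≡n j≤j′
... | inj₁ j<j′ = <-trans (p-strictMono j<j′) (p-<-suc j′)
... | inj₂ refl = p-<-suc j

p-mono : j ≤ j′ → p j ≤ p j′
p-mono j≤j′ with m≤n⇒m<n∨m≡n j≤j′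
... | inj₁ j<j′ = <⇒≤ (p-strictMono j<j′)
... | inj₂ refl = ≤-refl

p-injective : p j ≡ p j′ → j ≡ j′
p-injective {j} {j′} pj≡pj′ with <-cmp j j′
... | tri< j<j′ _ _ = ⊥-elim (<⇒≢ (p-strictMono j<j′) pj≡pj′)
... | tri≈ _ j≡j′ _ = j≡j′
... | tri> _ _ j>j′ = ⊥-elim (<⇒≢ (p-strictMono j>j′) (sym pj≡pj′))

prime<p⇒≡p : Prime ℓ → ℓ < p j → ∃ λ j′ → 1 ≤ j′ × j′ < j × ℓ ≡ p j′
prime<p⇒≡p {j = zero} pℓ ℓ<1 = ⊥-elim (<⇒≱ ℓ<1 (≤-trans (s≤s z≤n) (prime⇒≥2 pℓ)))
prime<p⇒≡p {ℓ} {suc j} pℓ ℓ<p with <-cmp ℓ (p j)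
... | tri< ℓ<pj _ _ = map₂ (map₂ (map₁ m<n⇒m<1+n)) (prime<p⇒≡p pℓ ℓ<pj)
... | tri> _ _ ℓ>pj = ⊥-elim (p-gap j ℓ>pj ℓ<p pℓ)
... | tri≈ _ refl _ with j
...   | zero  = ⊥-elim (¬prime[1] pℓ)
...   | suc i = suc i , s≤s z≤n , ≤-refl , refl

-- Finite sums and products

∑-cong : (∀ i → f i ≡ g i) → ∑ s f ≡ ∑ s g
∑-cong {zero}  f≗g = refl
∑-cong {suc s} f≗g = cong₂ _+_ (f≗g zero) (∑-cong (f≗g ∘ suc))

∑-zero : ∀ s → ∑ s (λ _ → 0) ≡ 0
∑-zero zero    = refl
∑-zero (suc s) = ∑-zero s

∑-+ : ∀ (f g : Fin s → ℕ) → ∑ s (λ i → f i + g i) ≡ ∑ s f + ∑ s g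
∑-+ {zero}  f g = refl
∑-+ {suc s} f g = begin
  f zero + g zero + ∑ s (λ i → f (suc i) + g (suc i))
    ≡⟨ cong (f zero + g zero +_) (∑-+ (f ∘ suc) (g ∘ suc)) ⟩
  f zero + g zero + (∑ s (f ∘ suc) + ∑ s (g ∘ suc))
    ≡⟨ +-CS.interchange (f zero) (g zero) _ _ ⟩
  f zero + ∑ s (f ∘ suc) + (g zero + ∑ s (g ∘ suc))
    ∎
  where open ≡-Reasoning

∑-*ʳ : ∀ (f : Fin s → ℕ) c → ∑ s (λ i → f i * c) ≡ ∑ s f * c
∑-*ʳ {zero}  f c = refl
∑-*ʳ {suc s} f c = trans (cong (f zero * c +_) (∑-*ʳ (f ∘ suc) c)) (sym (*-distribʳ-+ c (f zero) _))

∑-≤ : ∀ {c} → (∀ i → f i ≤ c) → ∑ s f ≤ s * c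
∑-≤ {zero}  f≤c = z≤n
∑-≤ {suc s} f≤c = +-mono-≤ (f≤c zero) (∑-≤ (f≤c ∘ suc))

∑-∣ : (∀ i → d ∣ f i) → d ∣ ∑ s f
∑-∣ {s = zero}  d∣f = _ ∣0
∑-∣ {s = suc s} d∣f = ∣m∣n⇒∣m+n (d∣f zero) (∑-∣ (d∣f ∘ suc))

∏-cong : (∀ i → f i ≡ g i) → ∏ s f ≡ ∏ s g
∏-cong {zero}  f≗g = refl
∏-cong {suc s} f≗g = cong₂ _*_ (f≗g zero) (∏-cong (f≗g ∘ suc))

∏-* : ∀ (f g : Fin s → ℕ) → ∏ s (λ i → f i * g i) ≡ ∏ s f * ∏ s g
∏-* {zero}  f g = refl
∏-* {suc s} f g =
  trans (cong (f zero * g zero *_) (∏-* (f ∘ suc) (g ∘ suc))) (*-CS.interchange (f zero) (g zero) _ _)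

∏-positive : (∀ i → 1 ≤ f i) → 1 ≤ ∏ s f
∏-positive {zero}  f≥1 = ≤-refl
∏-positive {suc s} f≥1 = *-mono-≤ (f≥1 zero) (∏-positive (f≥1 ∘ suc))

∣-∏ : ∀ (f : Fin s → ℕ) i → f i ∣ ∏ s f
∣-∏ f zero    = m∣m*n _
∣-∏ f (suc i) = ∣n⇒∣m*n (f zero) (∣-∏ (f ∘ suc) i)

∣-∏except : ∀ (f : Fin s → ℕ) {i h} → h ≢ i → f h ∣ ∏except s i f
∣-∏except f {zero}  {zero}  h≢i = ⊥-elim (h≢i refl)
∣-∏except f {zero}  {suc h} h≢i = ∣n⇒∣m*n 1 (∣-∏ (f ∘ suc) h)
∣-∏except f {suc i} {zero}  h≢i = m∣m*n _
∣-∏except f {suc i} {suc h} h≢i = ∣n⇒∣m*n (f zero) (∣-∏except (f ∘ suc) (h≢i ∘ cong suc))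

∏except-* : ∀ (f : Fin s → ℕ) i → ∏except s i f * f i ≡ ∏ s f
∏except-* {suc s} f zero = trans (cong (_* f zero) (+-identityʳ (∏ s (f ∘ suc)))) (*-comm _ (f zero))
∏except-* {suc s} f (suc i) = trans (*-assoc (f zero) _ _) (cong (f zero *_) (∏except-* (f ∘ suc) i))

coprime-∏ʳ : (∀ i → Coprime a (f i)) → Coprime a (∏ s f)
coprime-∏ʳ {s = zero}  a⊥f = Coprimality.sym coprime-1ˡ
coprime-∏ʳ {s = suc s} a⊥f = coprime-*ʳ (a⊥f zero) (coprime-∏ʳ (a⊥f ∘ suc))

coprime-∏exceptʳ : ∀ (f : Fin s → ℕ) i → (∀ h → h ≢ i → Coprime a (f h)) → Coprime a (∏except s i f)
coprime-∏exceptʳ f i a⊥f = coprime-∏ʳ λ h → term h (h Fin.≟ i)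
  where
  term : ∀ h → (h≟i : Dec (h ≡ i)) → Coprime _ (if does h≟i then 1 else f h)
  term h (yes _)   = Coprimality.sym coprime-1ˡ
  term h (no  h≢i) = a⊥f h h≢i

∏-∣ : (∀ i j → i ≢ j → Coprime (f i) (f j)) → (∀ i → f i ∣ d) → ∏ s f ∣ d
∏-∣ {s = zero}  _ _ = 1∣ _
∏-∣ {s = suc s} pairwise f∣d =
  coprime-∣-* (coprime-∏ʳ λ i → pairwise zero (suc i) λ ())
              (f∣d zero) (∏-∣ (λ i j i≢j → pairwise (suc i) (suc j) (i≢j ∘ Fin.suc-injective)) (f∣d ∘ suc))

∏range-positive : ∀ (f : ℕ → ℕ) b → (∀ j → 1 ≤ f j) → 1 ≤ ∏range b f
∏range-positive f zero    f≥1 = ≤-refl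
∏range-positive f (suc b) f≥1 = *-mono-≤ (∏range-positive f b f≥1) (f≥1 (suc b))

∏range-mono : ∀ (f : ℕ → ℕ) {b b′} → (∀ j → 1 ≤ f j) → b ≤ b′ → ∏range b f ≤ ∏range b′ f
∏range-mono f {b} {zero}   f≥1 z≤n  = ≤-refl
∏range-mono f {b} {suc b′} f≥1 b≤b′ with m≤n⇒m<n∨m≡n b≤b′
... | inj₁ (s≤s b≤b′) = subst (_≤ ∏range b′ f * f (suc b′)) (*-identityʳ _)
                              (*-mono-≤ (∏range-mono f f≥1 b≤b′) (f≥1 (suc b′)))
... | inj₂ refl = ≤-refl

∣-∏range : ∀ (f : ℕ → ℕ) {b} → 1 ≤ j → j ≤ b → f j ∣ ∏range b f
∣-∏range f {suc b} j≥1 j≤b with m≤n⇒m<n∨m≡n j≤b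
... | inj₁ (s≤s j≤b) = ∣m⇒∣m*n _ (∣-∏range f j≥1 j≤b)
... | inj₂ refl = n∣m*n (∏range b f)
∣-∏range f {zero} (s≤s z≤n) ()

prime∣∏range : ∀ (f : ℕ → ℕ) b → Prime ℓ → ℓ ∣ ∏range b f → ∃ λ j → 1 ≤ j × j ≤ b × ℓ ∣ f j
prime∣∏range f zero    pℓ ℓ∣1 = ⊥-elim (¬prime[1] (subst Prime (∣1⇒≡1 ℓ∣1) pℓ))
prime∣∏range f (suc b) pℓ ℓ∣ with euclidsLemma (∏range b f) (f (suc b)) pℓ ℓ∣
... | inj₁ ℓ∣∏ = map₂ (map₂ (map₁ m≤n⇒m≤1+n)) (prime∣∏range f b pℓ ℓ∣∏)
... | inj₂ ℓ∣f = suc b , s≤s z≤n , ≤-refl , ℓ∣f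

prime∣∏range-p : ∀ b → Prime ℓ → ℓ ∣ ∏range b p → ∃ λ j → j ≤ b × ℓ ≡ p j
prime∣∏range-p b pℓ ℓ∣ with prime∣∏range p b pℓ ℓ∣
... | j , j≥1 , j≤b , ℓ∣pj = j , j≤b , prime∣prime⇒≡ pℓ (p-prime j≥1) ℓ∣pj

avoidingFactor : (Fin s → ℕ) → ℕ → ℕ
avoidingFactor js j = if does (Fin.any? (λ i → j ≟ js i)) then 1 else p j

avoidingFactor-positive : ∀ (js : Fin s → ℕ) j → 1 ≤ avoidingFactor js j
avoidingFactor-positive js j with Fin.any? (λ i → j ≟ js i)
... | yes _ = ≤-refl
... | no  _ = p-positive j

avoidingFactor-∉ : ∀ (js : Fin s → ℕ) → (∀ i → j ≢ js i) → avoidingFactor js j ≡ p j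
avoidingFactor-∉ {j = j} js j∉ with Fin.any? (λ i → j ≟ js i)
... | yes (i , j≡) = ⊥-elim (j∉ i j≡)
... | no  _        = refl

prime∣avoidingFactor : ∀ (js : Fin s → ℕ) → Prime ℓ → ℓ ∣ avoidingFactor js j → (∀ i → j ≢ js i) × ℓ ∣ p j
prime∣avoidingFactor {j = j} js pℓ ℓ∣ with Fin.any? (λ i → j ≟ js i)
... | yes _ = ⊥-elim (¬prime[1] (subst Prime (∣1⇒≡1 ℓ∣) pℓ))
... | no  ∄ = (λ i j≡ → ∄ (i , j≡)) , ℓ∣

∏primesAvoiding-positive : ∀ (js : Fin s → ℕ) b → 1 ≤ ∏primesAvoiding s js b
∏primesAvoiding-positive js b = ∏range-positive (avoidingFactor js) b (avoidingFactor-positive js)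

∣-∏primesAvoiding : ∀ (js : Fin s → ℕ) {b} → 1 ≤ j → j ≤ b → (∀ i → j ≢ js i) → p j ∣ ∏primesAvoiding s js b
∣-∏primesAvoiding js j≥1 j≤b j∉ =
  subst (_∣ _) (avoidingFactor-∉ js j∉) (∣-∏range (avoidingFactor js) j≥1 j≤b)

prime∣∏primesAvoiding : ∀ (js : Fin s → ℕ) b → Prime ℓ → ℓ ∣ ∏primesAvoiding s js b →
  ∃ λ j → j ≤ b × (∀ i → j ≢ js i) × ℓ ≡ p j
prime∣∏primesAvoiding js b pℓ ℓ∣ with prime∣∏range (avoidingFactor js) b pℓ ℓ∣
... | j , j≥1 , j≤b , ℓ∣f with prime∣avoidingFactor js pℓ ℓ∣f
...   | j∉ , ℓ∣pj = j , j≤b , j∉ , prime∣prime⇒≡ pℓ (p-prime j≥1) ℓ∣pj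

Decreasing : (Fin s → ℕ) → Set
Decreasing {s} js = ∀ a b → a Data.Fin.< b → js b < js a

∏range-*-∏-decreasing-≤ : ∀ {s} (js : Fin (suc s) → ℕ) → Decreasing js → (∀ a → 1 ≤ js a) →
  ∏range (js (fromℕ s) ∸ 1) p * ∏ (suc s) (p ∘ js) ≤ ∏range (js zero) p
∏range-*-∏-decreasing-≤ {zero} js _ js≥1 with js zero | js≥1 zero
... | suc j | _ = ≤-reflexive (cong (∏range j p *_) (*-identityʳ (p (suc j))))
∏range-*-∏-decreasing-≤ {suc s} js js↓ js≥1 with js zero in js₀≡ | js≥1 zero
... | suc j | _ = begin
  below * (p (suc j) * ∏ (suc s) (p ∘ js ∘ suc))  ≡⟨ *-CS.x∙yz≈xz∙y below _ _ ⟩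
  below * ∏ (suc s) (p ∘ js ∘ suc) * p (suc j)    ≤⟨ *-monoˡ-≤ _ rest ⟩
  ∏range (js (suc zero)) p * p (suc j)             ≤⟨ *-monoˡ-≤ _ (∏range-mono p p-positive js₁≤j) ⟩
  ∏range j p * p (suc j)                           ∎
  where
  open ≤-Reasoning
  below = ∏range (js (fromℕ (suc s)) ∸ 1) p
  rest = ∏range-*-∏-decreasing-≤ (js ∘ suc) (λ a b a<b → js↓ (suc a) (suc b) (s≤s a<b)) (js≥1 ∘ suc)
  js₁≤j : js (suc zero) ≤ j
  js₁≤j = s≤s⁻¹ (subst (js (suc zero) <_) js₀≡ (js↓ zero (suc zero) (s≤s z≤n)))

-- Congruences

infix 4 _≡_mod_
_≡_mod_ : ℕ → ℕ → ℕ → Set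
a ≡ b mod d = ∃₂ λ u v → a + u * d ≡ b + v * d

≡-mod-trans : a ≡ b mod d → b ≡ c mod d → a ≡ c mod d
≡-mod-trans {a} {b} {d} {c} (u , v , a≡b) (u′ , v′ , b≡c) = u + u′ , v′ + v , (begin
  a + (u + u′) * d      ≡⟨ cong (a +_) (*-distribʳ-+ d u u′) ⟩
  a + (u * d + u′ * d)  ≡⟨ sym (+-assoc a _ _) ⟩
  a + u * d + u′ * d    ≡⟨ cong (_+ u′ * d) a≡b ⟩
  b + v * d + u′ * d    ≡⟨ +-CS.xy∙z≈xz∙y b _ _ ⟩
  b + u′ * d + v * d    ≡⟨ cong (_+ v * d) b≡c ⟩
  c + v′ * d + v * d    ≡⟨ +-assoc c _ _ ⟩
  c + (v′ * d + v * d)  ≡⟨ cong (c +_) (sym (*-distribʳ-+ d v′ v)) ⟩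
  c + (v′ + v) * d      ∎)
  where open ≡-Reasoning

≡-mod-+ˡ : ∀ c → a ≡ b mod d → c + a ≡ c + b mod d
≡-mod-+ˡ {a} {b} c (u , v , a≡b) =
  u , v , trans (+-assoc c a _) (trans (cong (c +_) a≡b) (sym (+-assoc c b _)))

+-*-≡-mod : ∀ a k d → a + k * d ≡ a mod d
+-*-≡-mod a k d = 0 , k , +-identityʳ (a + k * d)

≡-mod⇒∣∸ : a ≡ b mod d → a ≤ b → d ∣ b ∸ a
≡-mod⇒∣∸ {a} {b} {d} (u , v , a≡b) a≤b = ∣m+n∣m⇒∣n (subst (d ∣_) ud≡ (n∣m*n u)) (n∣m*n v)
  where
  open ≡-Reasoning
  ud≡ : u * d ≡ v * d + (b ∸ a)
  ud≡ = +-cancelˡ-≡ a _ _ (begin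
    a + u * d              ≡⟨ a≡b ⟩
    b + v * d              ≡⟨ cong (_+ v * d) (sym (m+[n∸m]≡n a≤b)) ⟩
    a + (b ∸ a) + v * d    ≡⟨ +-CS.xy∙z≈x∙zy a _ _ ⟩
    a + (v * d + (b ∸ a))  ∎)

≡1-mod⇒coprime : a ≡ 1 mod d → Coprime d a
≡1-mod⇒coprime {a} {d} (u , v , a≡1) {e} (e∣d , e∣a) = ∣1⇒≡1 (∣m+n∣m⇒∣n e∣vd+1 (∣n⇒∣m*n v e∣d))
  where
  e∣vd+1 : e ∣ v * d + 1
  e∣vd+1 = subst (e ∣_) (trans a≡1 (+-comm 1 (v * d))) (∣m∣n⇒∣m+n e∣a (∣n⇒∣m*n u e∣d))

bézout-solution : ∀ {Q M} → Coprime Q M → .{{NonZero M}} → ∀ t → ∃ λ r → r * Q ≡ t mod M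
bézout-solution {Q} {M} Q⊥M t with coprime-Bézout Q⊥M
... | Bézout.+- x y 1+yM≡xQ = t * x , 0 , t * y , (begin
  t * x * Q + 0 * M  ≡⟨ regroup₁ t x Q M ⟩
  t * (x * Q)        ≡⟨ cong (t *_) (sym 1+yM≡xQ) ⟩
  t * (1 + y * M)    ≡⟨ regroup₂ t y M ⟩
  t + t * y * M      ∎)
  where
  open ≡-Reasoning
  regroup₁ : ∀ t x Q M → t * x * Q + 0 * M ≡ t * (x * Q)
  regroup₁ = solve-∀
  regroup₂ : ∀ t y M → t * (1 + y * M) ≡ t + t * y * M
  regroup₂ = solve-∀
-- From 1 + x Q = y M: r = t x (M - 1) gives r Q ≡ - t (M - 1) ≡ t.
... | Bézout.-+ x y 1+xQ≡yM = t * x * pred M , t , t * pred M * y , (begin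
  t * x * pred M * Q + t * M              ≡⟨ cong (λ M′ → t * x * pred M * Q + t * M′) (sym (suc-pred M)) ⟩
  t * x * pred M * Q + t * suc (pred M)   ≡⟨ regroup₁ t x (pred M) Q ⟩
  t * pred M * (1 + x * Q) + t            ≡⟨ cong (λ z → t * pred M * z + t) 1+xQ≡yM ⟩
  t * pred M * (y * M) + t                ≡⟨ regroup₂ t (pred M) y M ⟩
  t + t * pred M * y * M                  ∎)
  where
  open ≡-Reasoning
  regroup₁ : ∀ t x m Q → t * x * m * Q + t * suc m ≡ t * m * (1 + x * Q) + t
  regroup₁ = solve-∀
  regroup₂ : ∀ t m y M → t * m * (y * M) + t ≡ t + t * m * y * M
  regroup₂ = solve-∀

%-≡-mod : ∀ r Q M .{{_ : NonZero M}} → r % M * Q ≡ r * Q mod M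
%-≡-mod r Q M = r / M * Q , 0 , (begin
  r % M * Q + r / M * Q * M  ≡⟨ regroup (r % M) (r / M) Q M ⟩
  (r % M + r / M * M) * Q    ≡⟨ cong (_* Q) (sym (m≡m%n+[m/n]*n r M)) ⟩
  r * Q                      ≡⟨ sym (+-identityʳ (r * Q)) ⟩
  r * Q + 0 * M              ∎)
  where
  open ≡-Reasoning
  regroup : ∀ a b Q M → a * Q + b * Q * M ≡ (a + b * M) * Q
  regroup = solve-∀

∑-≡-mod : ∀ (f : Fin s → ℕ) i → (∀ h → h ≢ i → d ∣ f h) → ∑ s f ≡ f i mod d
∑-≡-mod {suc s} {d} f zero    d∣f with ∑-∣ {f = f ∘ suc} (λ h → d∣f (suc h) λ ())
... | divides w ∑≡wd = subst (λ z → f zero + z ≡ f zero mod d) (sym ∑≡wd) (+-*-≡-mod (f zero) w d)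
∑-≡-mod {suc s} {d} f (suc i) d∣f with d∣f zero (λ ())
... | divides w f₀≡wd =
  ≡-mod-trans (≡-mod-+ˡ (f zero) rest) (subst (λ z → z + f (suc i) ≡ f (suc i) mod d) (sym f₀≡wd) drop)
  where
  rest = ∑-≡-mod (f ∘ suc) i (λ h h≢i → d∣f (suc h) (h≢i ∘ Fin.suc-injective))
  drop = subst (_≡ f (suc i) mod d) (+-comm (f (suc i)) (w * d)) (+-*-≡-mod (f (suc i)) w d)

linear-congruence : ∀ {Q M} → Coprime Q M → .{{NonZero M}} → ∀ t → ∃ λ r → r < M × r * Q ≡ t mod M
linear-congruence {Q} {M} Q⊥M t with bézout-solution Q⊥M t
... | r , rQ≡t = r % M , m%n<n r M , ≡-mod-trans (%-≡-mod r Q M) rQ≡t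

-- Sieving an arithmetic progression

survivor : ∀ {N K} → N < K → (Kills : Fin N → Fin K → Set) → (∀ a i → Dec (Kills a i)) →
  (∀ {a i j} → Kills a i → Kills a j → i ≡ j) → ∃ λ i → ∀ a → ¬ Kills a i
survivor {N} N<K Kills kills? unique with Fin.any? (λ i → Fin.all? (λ a → ¬? (kills? a i)))
... | yes found = found
... | no  none  = ⊥-elim (collision (Fin.pigeonhole N<K (proj₁ ∘ killed)))
  where
  killed : ∀ i → ∃ λ a → Kills a i
  killed i = map₂ (λ {a} → decidable-stable (kills? a i))
                  (Fin.¬∀⟶∃¬ N (λ a → ¬ Kills a i) (λ a → ¬? (kills? a i)) λ all → none (i , all))
  collision : (∃₂ λ i j → i Data.Fin.< j × proj₁ (killed i) ≡ proj₁ (killed j)) → ⊥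
  collision (i , j , i<j , same) =
    <⇒≢ i<j (cong toℕ (unique (proj₂ (killed i)) (subst (λ a → Kills a j) (sym same) (proj₂ (killed j)))))

progression-step : ∀ Y Z {u v} → u ≤ v → Y + v * Z ≡ Y + u * Z + (v ∸ u) * Z
progression-step Y Z {u} {v} u≤v = begin
  Y + v * Z                  ≡⟨ cong (λ w → Y + w * Z) (sym (m+[n∸m]≡n u≤v)) ⟩
  Y + (u + (v ∸ u)) * Z      ≡⟨ cong (Y +_) (*-distribʳ-+ Z u (v ∸ u)) ⟩
  Y + (u * Z + (v ∸ u) * Z)  ≡⟨ sym (+-assoc Y _ _) ⟩
  Y + u * Z + (v ∸ u) * Z    ∎
  where open ≡-Reasoning

prime∤-progression-twice : ∀ {Y Z u v} → Prime ℓ → ¬ ℓ ∣ Z → u < v → v < ℓ →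
  ℓ ∣ Y + u * Z → ℓ ∣ Y + v * Z → ⊥
prime∤-progression-twice {ℓ} {Y} {Z} {u} {v} pℓ ℓ∤Z u<v v<ℓ ℓ∣u ℓ∣v
  with euclidsLemma (v ∸ u) Z pℓ ℓ∣[v∸u]Z
  where
  ℓ∣[v∸u]Z : ℓ ∣ (v ∸ u) * Z
  ℓ∣[v∸u]Z = ∣m+n∣m⇒∣n (subst (ℓ ∣_) (progression-step Y Z (<⇒≤ u<v)) ℓ∣v) ℓ∣u
... | inj₁ ℓ∣v∸u =
  <-irrefl refl (≤-<-trans (∣⇒≤ {{>-nonZero (m<n⇒0<n∸m u<v)}} ℓ∣v∸u) (≤-<-trans (m∸n≤m v u) v<ℓ))
... | inj₂ ℓ∣Z   = ℓ∤Z ℓ∣Z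

prime∣-progression-unique : ∀ {Y Z u v} → Prime ℓ → ¬ ℓ ∣ Z → u < ℓ → v < ℓ →
  ℓ ∣ Y + u * Z → ℓ ∣ Y + v * Z → u ≡ v
prime∣-progression-unique {u = u} {v} pℓ ℓ∤Z u<ℓ v<ℓ ℓ∣u ℓ∣v with <-cmp u v
... | tri< u<v _ _ = ⊥-elim (prime∤-progression-twice pℓ ℓ∤Z u<v v<ℓ ℓ∣u ℓ∣v)
... | tri≈ _ u≡v _ = u≡v
... | tri> _ _ v<u = ⊥-elim (prime∤-progression-twice pℓ ℓ∤Z v<u u<ℓ ℓ∣v ℓ∣u)

-- Each prime ℓ a ≥ K hits at most one of the K terms, and there are fewer than K of them.
avoid-progression : ∀ {N K} Y Z (ℓ : Fin N → ℕ) → N < K → (∀ a → Prime (ℓ a)) → (∀ a → K ≤ ℓ a) →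
  (∀ a → ¬ ℓ a ∣ Z) → ∃ λ i → i < K × ∀ a → ¬ ℓ a ∣ Y + i * Z
avoid-progression {K = K} Y Z ℓ N<K ℓ-prime K≤ℓ ℓ∤Z with survivor N<K Hits (λ a i → ℓ a ∣? _) unique
  where
  Hits : _ → Fin K → Set
  Hits a i = ℓ a ∣ Y + toℕ i * Z
  unique : ∀ {a i j} → Hits a i → Hits a j → i ≡ j
  unique {a} {i} {j} hi hj = Fin.toℕ-injective
    (prime∣-progression-unique (ℓ-prime a) (ℓ∤Z a) (below i) (below j) hi hj)
    where
    below : ∀ i → toℕ i < ℓ a
    below i = <-≤-trans (Fin.toℕ<n i) (K≤ℓ a)
... | i , avoids = toℕ i , Fin.toℕ<n i , avoids

sieve : ∀ {N K} y X A .{{_ : NonZero A}} (ℓ : Fin N → ℕ) → Coprime X A → N < K →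
  (∀ a → Prime (ℓ a)) → (∀ a → K ≤ ℓ a) → (∀ a → ¬ ℓ a ∣ X * A) →
  ∃ λ k → k < K * A × Coprime A (y + k * X) × ∀ a → ¬ ℓ a ∣ y + k * X
-- a₀ X ≡ 1 - y (mod A), with the right-hand side written as 1 + (A - 1) y to stay in ℕ.
sieve {K = K} y X A ℓ X⊥A N<K ℓ-prime K≤ℓ ℓ∤XA with linear-congruence X⊥A (1 + pred A * y)
... | a₀ , a₀<A , a₀X≡ with avoid-progression (y + a₀ * X) (X * A) ℓ N<K ℓ-prime K≤ℓ ℓ∤XA
...   | i , i<K , avoids =
  a₀ + i * A , k<KA ,
  ≡1-mod⇒coprime (≡-mod-trans (subst (_≡ y + a₀ * X mod A) (sym progression) (+-*-≡-mod _ (i * X) A)) start) ,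
  λ a → avoids a ∘ subst (ℓ a ∣_) (trans progression (cong (y + a₀ * X +_) (*-assoc i X A)))
  where
  progression : y + (a₀ + i * A) * X ≡ y + a₀ * X + i * X * A
  progression = regroup y a₀ i A X
    where
    regroup : ∀ y a i A X → y + (a + i * A) * X ≡ y + a * X + i * X * A
    regroup = solve-∀
  start : y + a₀ * X ≡ 1 mod A
  start = ≡-mod-trans (subst (y + a₀ * X ≡_mod A) y+[1+[A-1]y]≡1+yA (≡-mod-+ˡ y a₀X≡)) (+-*-≡-mod 1 y A)
    where
    y+[1+[A-1]y]≡1+yA : y + (1 + pred A * y) ≡ 1 + y * A
    y+[1+[A-1]y]≡1+yA = trans (regroup y (pred A)) (cong (λ A′ → 1 + y * A′) (suc-pred A))
      where
      regroup : ∀ y m → y + (1 + m * y) ≡ 1 + y * suc m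
      regroup = solve-∀
  k<KA : a₀ + i * A < K * A
  k<KA = <-≤-trans (+-monoˡ-< (i * A) a₀<A) (*-monoˡ-≤ A i<K)

-- The representation

isPowGcd-1 : ∀ {m s} (x : Fin s → ℕ) {b c : Fin s} {B} → 1 ≤ m → 1 ≤ x c → x c < B ^ m →
  (∀ {ℓ} → Prime ℓ → ℓ < B → ¬ ℓ ∣ x b) → IsPowGcd m s x 1
isPowGcd-1 {suc m} x {b} {c} {B} _ xc≥1 xc<B^m no-small-factor =
  (1 , sym (^-zeroˡ (suc m)) , λ i → 1∣ x i) , bound
  where
  bound : ∀ d → (∀ i → d ^ suc m ∣ x i) → d ^ suc m ≤ 1
  bound zero          _     = z≤n
  bound (suc zero)    _     = ≤-reflexive (^-zeroˡ (suc m))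
  bound (suc (suc d)) d^m∣x with ∃-prime-divisor {2 + d} (s≤s (s≤s z≤n))
  ... | ℓ , pℓ , ℓ∣d = ⊥-elim (no-small-factor pℓ ℓ<B (∣-trans ℓ∣d (∣-trans (m∣m*n ((2 + d) ^ m)) (d^m∣x b))))
    where
    ℓ^m≤xc : ℓ ^ suc m ≤ x c
    ℓ^m≤xc = ∣⇒≤ {{>-nonZero xc≥1}} (∣-trans (^-monoˡ-∣ (suc m) ℓ∣d) (d^m∣x c))
    ℓ<B : ℓ < B
    ℓ<B = ≰⇒> λ B≤ℓ → <⇒≱ (≤-<-trans ℓ^m≤xc xc<B^m) (^-monoˡ-≤ (suc m) B≤ℓ)

module Representation
  (s′ m : ℕ) (m≥1 : 1 ≤ m) (q : Fin (3 + s′) → ℕ)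
  (q-prime : ∀ i → Prime (q i)) (q-injective : ∀ {i j} → q i ≡ q j → i ≡ j)
  (n : ℕ) (n⊥∏q : Coprime n (∏ (3 + s′) q))
  where

  size : ℕ
  size = 3 + s′

  M Q : Fin size → ℕ
  M i = q i ^ m
  Q i = ∏except size i M

  P : ℕ
  P = ∏ size M

  i₂ iₛ : Fin size
  i₂ = suc zero
  iₛ = fromℕ (2 + s′)

  M-positive : ∀ i → 1 ≤ M i
  M-positive i = m^n>0 (q i) {{prime⇒nonZero (q-prime i)}} m

  M-pairwise-coprime : ∀ i j → i ≢ j → Coprime (M i) (M j)
  M-pairwise-coprime i j i≢j =
    coprime-^ˡ m (coprime-^ʳ m (distinct-primes-coprime (q-prime i) (q-prime j) (i≢j ∘ q-injective)))

  Q⊥M : ∀ i → Coprime (Q i) (M i)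
  Q⊥M i = Coprimality.sym (coprime-∏exceptʳ M i λ h h≢i → M-pairwise-coprime i h (h≢i ∘ sym))

  -- Opaque, so that r i never unfolds to the Bézout computation during unification.
  opaque
    residue : ∀ i → ∃ λ r → r < M i × r * Q i ≡ n mod M i
    residue i = linear-congruence (Q⊥M i) {{>-nonZero (M-positive i)}} n

  r : Fin size → ℕ
  r = proj₁ ∘ residue

  R : ℕ
  R = ∑ size (λ i → r i * Q i)

  R≤size*P : R ≤ size * P
  R≤size*P = ∑-≤ λ i → subst (r i * Q i ≤_) (trans (*-comm (M i) (Q i)) (∏except-* M i))
                               (*-monoˡ-≤ (Q i) (<⇒≤ (proj₁ (proj₂ (residue i)))))

  P∣n∸R : R ≤ n → P ∣ n ∸ R
  P∣n∸R R≤n = ∏-∣ M-pairwise-coprime λ i → ≡-mod⇒∣∸ (R≡n i) R≤n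
    where
    R≡n : ∀ i → R ≡ n mod M i
    R≡n i = ≡-mod-trans (∑-≡-mod _ i λ h h≢i → ∣n⇒∣m*n (r h) (∣-∏except M (h≢i ∘ sym)))
                        (proj₂ (proj₂ (residue i)))

  ∑-affine : ∀ t → ∑ size (λ i → (r i + t i * M i) * Q i) ≡ R + ∑ size t * P
  ∑-affine t = begin
    ∑ size (λ i → (r i + t i * M i) * Q i)  ≡⟨ ∑-cong expand ⟩
    ∑ size (λ i → r i * Q i + t i * P)      ≡⟨ ∑-+ (λ i → r i * Q i) (λ i → t i * P) ⟩
    R + ∑ size (λ i → t i * P)              ≡⟨ cong (R +_) (∑-*ʳ t P) ⟩
    R + ∑ size t * P                        ∎
    where
    open ≡-Reasoning
    regroup : ∀ r t M Q → (r + t * M) * Q ≡ r * Q + t * (Q * M)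
    regroup = solve-∀
    expand : ∀ i → (r i + t i * M i) * Q i ≡ r i * Q i + t i * P
    expand i = trans (regroup (r i) (t i) (M i) (Q i)) (cong (λ z → r i * Q i + t i * z) (∏except-* M i))

  q∤x : ∀ (x : Fin size → ℕ) → n ≡ ∑ size (λ i → x i * Q i) → ∀ i → ¬ q i ∣ x i
  q∤x x n≡∑xQ i qi∣xi = ¬prime[1] (subst Prime (n⊥∏q (qi∣n , ∣-∏ q i)) (q-prime i))
    where
    qi∣term : ∀ h → q i ∣ x h * Q h
    qi∣term h with h Fin.≟ i
    ... | yes refl = ∣m⇒∣m*n (Q i) qi∣xi
    ... | no  h≢i  = ∣n⇒∣m*n (x h) (∣-trans (∣-^ m m≥1) (∣-∏except M (h≢i ∘ sym)))
    qi∣n : q i ∣ n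
    qi∣n = subst (q i ∣_) (sym n≡∑xQ) (∑-∣ qi∣term)

  Conclusion : Set
  Conclusion = ∃ λ (x : Fin size → ℕ) →
      ((i : Fin size) → 1 ≤ x i)
    × (n ≡ ∑ size (λ i → x i * Q i))
    × IsPowGcd m size x 1
    × ((i : Fin size) → Coprime (q i) (x i))

  -- All of T goes into the first two coordinates, which leaves x iₛ = r iₛ < q iₛ ^ m.
  conclusion : ∀ T k → n ≡ R + T * P → k ≤ T →
    (∀ {ℓ} → Prime ℓ → ℓ < q iₛ → ¬ ℓ ∣ r i₂ + k * M i₂) → Conclusion
  conclusion T k n≡R+TP k≤T no-small-factor =
    x , x-positive , n≡∑xQ , isPowGcd-1 x m≥1 (x-positive iₛ) xc<Mc no-small-factor ,
    λ i → prime∤⇒coprime (q-prime i) (q∤x x n≡∑xQ i)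
    where
    t : Fin size → ℕ
    t zero          = T ∸ k
    t (suc zero)    = k
    t (suc (suc _)) = 0
    x : Fin size → ℕ
    x i = r i + t i * M i
    ∑t≡T : ∑ size t ≡ T
    ∑t≡T = trans (cong (λ z → T ∸ k + (k + z)) (∑-zero s′))
                 (trans (cong (T ∸ k +_) (+-identityʳ k)) (m∸n+n≡m k≤T))
    n≡∑xQ : n ≡ ∑ size (λ i → x i * Q i)
    n≡∑xQ = trans n≡R+TP (sym (trans (∑-affine t) (cong (λ z → R + z * P) ∑t≡T)))
    x-positive : ∀ i → 1 ≤ x i
    x-positive i with x i | q∤x x n≡∑xQ i
    ... | zero  | qi∤0 = ⊥-elim (qi∤0 (_ ∣0))
    ... | suc _ | _    = s≤s z≤n
    xc<Mc : x iₛ < q iₛ ^ m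
    xc<Mc = subst (_< M iₛ) (sym (+-identityʳ (r iₛ))) (proj₁ (proj₂ (residue iₛ)))

  record Sieve : Set where
    field
      A K N        : ℕ
      ℓs           : Fin N → ℕ
      A-positive   : 1 ≤ A
      M-i₂⊥A       : Coprime (M i₂) A
      N<K          : N < K
      ℓs-prime     : ∀ a → Prime (ℓs a)
      K≤ℓs         : ∀ a → K ≤ ℓs a
      ℓs∤M-i₂*A    : ∀ a → ¬ ℓs a ∣ M i₂ * A
      small-primes : ∀ {ℓ′} → Prime ℓ′ → ℓ′ < q iₛ → ℓ′ ∣ A ⊎ ∃ λ a → ℓ′ ≡ ℓs a
      n-large      : (size + K * A) * P ≤ n

  representation : Sieve → Conclusion
  representation sv =
    from-multiplier (sieve (r i₂) (M i₂) A {{>-nonZero A-positive}} ℓs M-i₂⊥A N<K ℓs-prime K≤ℓs ℓs∤M-i₂*A)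
    where
    open Sieve sv
    R≤n : R ≤ n
    R≤n = ≤-trans R≤size*P (≤-trans (*-monoˡ-≤ P (m≤m+n size (K * A))) n-large)
    T : ℕ
    T = quotient (P∣n∸R R≤n)
    n≡R+TP : n ≡ R + T * P
    n≡R+TP = trans (sym (m+[n∸m]≡n R≤n)) (cong (R +_) (m∣n⇒n≡quotient*m (P∣n∸R R≤n)))
    K*A≤T : K * A ≤ T
    K*A≤T = *-cancelʳ-≤ (K * A) T P {{>-nonZero (∏-positive M-positive)}} (+-cancelˡ-≤ (size * P) _ _ (begin
      size * P + K * A * P  ≡⟨ sym (*-distribʳ-+ P size (K * A)) ⟩
      (size + K * A) * P    ≤⟨ n-large ⟩
      n                     ≡⟨ n≡R+TP ⟩
      R + T * P             ≤⟨ +-monoˡ-≤ (T * P) R≤size*P ⟩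
      size * P + T * P      ∎))
      where open ≤-Reasoning
    from-multiplier : (∃ λ k → k < K * A × Coprime A (r i₂ + k * M i₂) × ∀ a → ¬ ℓs a ∣ r i₂ + k * M i₂) →
      Conclusion
    from-multiplier (k , k<KA , A⊥x₂ , ℓs∤x₂) =
      conclusion T k n≡R+TP (≤-trans (<⇒≤ k<KA) K*A≤T) no-small-factor
      where
      no-small-factor : ∀ {ℓ′} → Prime ℓ′ → ℓ′ < q iₛ → ¬ ℓ′ ∣ r i₂ + k * M i₂
      no-small-factor pℓ′ ℓ′<qₛ ℓ′∣x₂ with small-primes pℓ′ ℓ′<qₛ
      ... | inj₁ ℓ′∣A       = ¬prime[1] (subst Prime (A⊥x₂ (ℓ′∣A , ℓ′∣x₂)) pℓ′)
      ... | inj₂ (a , refl) = ℓs∤x₂ a ℓ′∣x₂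

module Sieves
  (s′ m : ℕ) (m≥1 : 1 ≤ m) (js : Fin (3 + s′) → ℕ) (js↓ : Decreasing js) (js≥1 : ∀ a → 1 ≤ js a)
  (n : ℕ) (n⊥∏q : Coprime n (∏ (3 + s′) (λ i → p (js i))))
  where

  js-injective : ∀ {i j} → js i ≡ js j → i ≡ j
  js-injective {i} {j} jsi≡jsj with Fin.<-cmp i j
  ... | tri< i<j _ _ = ⊥-elim (<⇒≢ (js↓ i j i<j) (sym jsi≡jsj))
  ... | tri≈ _ i≡j _ = i≡j
  ... | tri> _ _ j<i = ⊥-elim (<⇒≢ (js↓ j i j<i) jsi≡jsj)

  q : Fin (3 + s′) → ℕ
  q i = p (js i)

  q-prime : ∀ i → Prime (q i)
  q-prime i = p-prime (js≥1 i)

  open Representation s′ m m≥1 q q-prime (js-injective ∘ p-injective) n n⊥∏q public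

  js-last-≤ : ∀ i → js iₛ ≤ js i
  js-last-≤ i with m≤n⇒m<n∨m≡n (Fin.≤fromℕ i)
  ... | inj₁ i<iₛ = <⇒≤ (js↓ i iₛ i<iₛ)
  ... | inj₂ i≡iₛ = ≤-reflexive (cong js (sym (Fin.toℕ-injective i≡iₛ)))

  js-last<js₂ : js iₛ < js i₂
  js-last<js₂ = js↓ i₂ iₛ (s≤s (s≤s z≤n))

  A₂ : ℕ
  A₂ = ∏range (js iₛ ∸ 1) p

  A₂-positive : 1 ≤ A₂
  A₂-positive = ∏range-positive p (js iₛ ∸ 1) p-positive

  q₂∤A₂ : ¬ q i₂ ∣ A₂
  q₂∤A₂ q₂∣A with prime∣∏range-p (js iₛ ∸ 1) (q-prime i₂) q₂∣A
  ... | j , j≤ , q₂≡pj = <⇒≱ (<-trans (m≤pred[n]⇒suc[m]≤n {{>-nonZero (js≥1 iₛ)}} j≤) js-last<js₂)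
                              (≤-reflexive (p-injective q₂≡pj))

  no-prime : Fin 0 → ℕ
  no-prime ()

  small-primes₂ : ∀ {ℓ′} → Prime ℓ′ → ℓ′ < q iₛ → ℓ′ ∣ A₂ ⊎ ∃ λ a → ℓ′ ≡ no-prime a
  small-primes₂ pℓ′ ℓ′< with prime<p⇒≡p {j = js iₛ} pℓ′ ℓ′<
  ... | j , j≥1 , j< , refl = inj₁ (∣-∏range p {js iₛ ∸ 1} j≥1 (<⇒≤pred j<))

  sieve₂ : (size + 1) * ∏range (js zero) p * ∏ size (λ i → p (js i) ^ (m ∸ 1)) ≤ n → Sieve
  sieve₂ n-large = record
    { A = A₂ ; K = 1 ; N = 0 ; ℓs = no-prime ; A-positive = A₂-positive
    ; M-i₂⊥A = coprime-^ˡ m (prime∤⇒coprime (q-prime i₂) q₂∤A₂) ; N<K = s≤s z≤n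
    ; ℓs-prime = λ () ; K≤ℓs = λ () ; ℓs∤M-i₂*A = λ ()
    ; small-primes = small-primes₂ ; n-large = bound }
    where
    ∏q ∏q′ : ℕ
    ∏q  = ∏ size q
    ∏q′ = ∏ size (λ i → q i ^ (m ∸ 1))
    P≡ : P ≡ ∏q * ∏q′
    P≡ = trans (∏-cong λ i → ^-pred (q i) m m≥1) (∏-* q (λ i → q i ^ (m ∸ 1)))
    A*∏q≤ : A₂ * ∏q ≤ ∏range (js zero) p
    A*∏q≤ = ∏range-*-∏-decreasing-≤ js js↓ js≥1
    size+A≤[size+1]*A : size + 1 * A₂ ≤ (size + 1) * A₂
    size+A≤[size+1]*A = subst (size + 1 * A₂ ≤_) (sym (*-distribʳ-+ A₂ size 1))
                          (+-monoˡ-≤ (1 * A₂) (m≤m*n size A₂ {{>-nonZero A₂-positive}}))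
    regroup : ∀ a b c d → a * b * (c * d) ≡ a * (b * c) * d
    regroup = solve-∀
    bound : (size + 1 * A₂) * P ≤ n
    bound = begin
      (size + 1 * A₂) * P                    ≡⟨ cong ((size + 1 * A₂) *_) P≡ ⟩
      (size + 1 * A₂) * (∏q * ∏q′)           ≤⟨ *-monoˡ-≤ (∏q * ∏q′) size+A≤[size+1]*A ⟩
      (size + 1) * A₂ * (∏q * ∏q′)           ≡⟨ regroup (size + 1) A₂ ∏q ∏q′ ⟩
      (size + 1) * (A₂ * ∏q) * ∏q′           ≤⟨ *-monoˡ-≤ ∏q′ (*-monoʳ-≤ (size + 1) A*∏q≤) ⟩
      (size + 1) * ∏range (js zero) p * ∏q′  ≤⟨ n-large ⟩
      n                                      ∎
      where open ≤-Reasoning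

  K₁ lo : ℕ
  K₁ = 2 ^ ((m + 1) * size)
  lo = js zero ∸ (m + 1) * size

  A₁ : ℕ
  A₁ = ∏primesAvoiding size js (lo ∸ 1)

  ℓs₁ : Fin (js iₛ ∸ lo) → ℕ
  ℓs₁ a = p (lo + toℕ a)

  lo+a<jsₛ : ∀ a → lo + toℕ a < js iₛ
  lo+a<jsₛ a = subst (_≤ js iₛ) (trans (+-comm (suc (toℕ a)) lo) (+-suc lo (toℕ a)))
                     (m≤o∸n⇒m+n≤o (suc (toℕ a)) lo≤jsₛ (Fin.toℕ<n a))
    where
    lo≤jsₛ : lo ≤ js iₛ
    lo≤jsₛ = <⇒≤ (m∸n≢0⇒n<m (<⇒≢ (≤-<-trans z≤n (Fin.toℕ<n a)) ∘ sym))

  q₂∤A₁ : ¬ q i₂ ∣ A₁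
  q₂∤A₁ q₂∣A with prime∣∏primesAvoiding js (lo ∸ 1) (q-prime i₂) q₂∣A
  ... | j , _ , j∉ , q₂≡pj = j∉ i₂ (sym (p-injective q₂≡pj))

  N<K₁ : js iₛ ∸ lo < K₁
  N<K₁ = ≤-<-trans (m≤n+o⇒m∸n≤o (js iₛ) lo jsₛ≤lo+t) (n<2^n ((m + 1) * size))
    where
    jsₛ≤lo+t : js iₛ ≤ lo + (m + 1) * size
    jsₛ≤lo+t = ≤-trans (js-last-≤ zero)
                 (subst (js zero ≤_) (+-comm ((m + 1) * size) lo) (m≤n+m∸n (js zero) ((m + 1) * size)))

  small-primes₁ : ∀ {ℓ′} → Prime ℓ′ → ℓ′ < q iₛ → ℓ′ ∣ A₁ ⊎ ∃ λ a → ℓ′ ≡ ℓs₁ a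
  small-primes₁ pℓ′ ℓ′< with prime<p⇒≡p {j = js iₛ} pℓ′ ℓ′<
  ... | j , j≥1 , j<jsₛ , refl with j <? lo
  ...   | yes j<lo = inj₁ (∣-∏primesAvoiding js j≥1 (<⇒≤pred j<lo) j∉js)
    where
    j∉js : ∀ i → j ≢ js i
    j∉js i j≡jsi = <⇒≱ j<jsₛ (subst (js iₛ ≤_) (sym j≡jsi) (js-last-≤ i))
  ...   | no  j≮lo = inj₂ (Data.Fin.fromℕ< j∸lo<N , cong p (sym lo+[j∸lo]≡j))
    where
    j∸lo<N = ∸-monoˡ-< j<jsₛ (≮⇒≥ j≮lo)
    lo+[j∸lo]≡j : lo + toℕ (Data.Fin.fromℕ< j∸lo<N) ≡ j
    lo+[j∸lo]≡j = trans (cong (lo +_) (Fin.toℕ-fromℕ< j∸lo<N)) (m+[n∸m]≡n (≮⇒≥ j≮lo))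

  sieve₁ : ((size + 1) + K₁ * A₁) * P ≤ n → K₁ < p lo → Sieve
  sieve₁ n-large K₁<p-lo = record
    { A = A₁ ; K = K₁ ; N = js iₛ ∸ lo ; ℓs = ℓs₁ ; A-positive = ∏primesAvoiding-positive js (lo ∸ 1)
    ; M-i₂⊥A = coprime-^ˡ m (prime∤⇒coprime (q-prime i₂) q₂∤A₁) ; N<K = N<K₁
    ; ℓs-prime = ℓs-prime ; K≤ℓs = K≤ℓs ; ℓs∤M-i₂*A = ℓs∤M-i₂*A
    ; small-primes = small-primes₁
    ; n-large = ≤-trans (*-monoˡ-≤ P (+-monoˡ-≤ (K₁ * A₁) (m≤m+n size 1))) n-large }
    where
    lo≥1 : 1 ≤ lo
    lo≥1 = 1<p⇒1≤ (≤-<-trans (m^n>0 2 ((m + 1) * size)) K₁<p-lo)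
    ℓs-prime : ∀ a → Prime (ℓs₁ a)
    ℓs-prime a = p-prime (≤-trans lo≥1 (m≤m+n lo (toℕ a)))
    K≤ℓs : ∀ a → K₁ ≤ ℓs₁ a
    K≤ℓs a = <⇒≤ (<-≤-trans K₁<p-lo (p-mono (m≤m+n lo (toℕ a))))
    ℓs∤M-i₂*A : ∀ a → ¬ ℓs₁ a ∣ M i₂ * A₁
    ℓs∤M-i₂*A a ℓ∣M*A with euclidsLemma (M i₂) A₁ (ℓs-prime a) ℓ∣M*A
    ... | inj₁ ℓ∣M = <⇒≢ (<-trans (lo+a<jsₛ a) js-last<js₂)
                       (p-injective (prime∣prime⇒≡ (ℓs-prime a) (q-prime i₂) (prime∣^⇒∣ m (ℓs-prime a) ℓ∣M)))
    ... | inj₂ ℓ∣A with prime∣∏primesAvoiding js (lo ∸ 1) (ℓs-prime a) ℓ∣A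
    ...   | j , j≤ , _ , ℓ≡pj = <⇒≱ (m≤pred[n]⇒suc[m]≤n {{>-nonZero lo≥1}} j≤)
                                    (≤-trans (m≤m+n lo (toℕ a)) (≤-reflexive (p-injective ℓ≡pj)))

mainTheorem10 : (s m : ℕ) → (s≥3 : 3 ≤ s) → 1 ≤ m →
    (js : Fin s → ℕ) →
    ((a b : Fin s) → a Data.Fin.< b → js b < js a) →
    ((a : Fin s) → 1 ≤ js a) →
    (n : ℕ) → 1 ≤ n →
    Coprime n (∏ s (λ i → p (js i))) →
    ((((s + 1) + 2 ^ ((m + 1) * s) * ∏primesAvoiding s js (first s≥3 js ∸ (m + 1) * s ∸ 1)) * ∏ s (λ i → p (js i) ^ m) ≤ n
       × 2 ^ ((m + 1) * s) < p (first s≥3 js ∸ (m + 1) * s))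
     ⊎ ((s + 1) * ∏range (first s≥3 js) p * ∏ s (λ i → p (js i) ^ (m ∸ 1)) ≤ n)) →
    ∃ λ (x : Fin s → ℕ) →
      ((i : Fin s) → 1 ≤ x i)
      × (n ≡ ∑ s (λ i → x i * ∏except s i (λ h → p (js h) ^ m)))
      × IsPowGcd m s x 1
      × ((i : Fin s) → Coprime (p (js i)) (x i))
mainTheorem10 .(3 + s′) m (s≤s (s≤s (s≤s {n = s′} _))) m≥1 js js↓ js≥1 n _ n⊥∏q condition =
  representation ([ uncurry sieve₁ , sieve₂ ]′ condition)
  where open Sieves s′ m m≥1 js js↓ js≥1 n n⊥∏q
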